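{- Let $q\in\mathbb{N}$ with $q\ge 3$ and let $\mathcal{A}\subseteq\{0,1,\ldots,q-1\}$ with $1<\#\mathcal{A}<q$. Let $p\in\mathbb{N}_{\ge2}$ with $\gcd(p,q)=1$. If $x,y\in\mathbb{Z}_p^*$ satisfy $x\sim_q y\pmod p$, then $x/p\in K(q,\mathcal{A})$ if and only if $y/p\in K(q,\mathcal{A})$.
   Context: $\mathbb{Z}_p^*:=\{1\le n\le p:\gcd(n,p)=1\}$. For $x,y\in\mathbb{Z}_p^*$, $x\sim_q y\pmod p$ means there exists $n\in\mathbb{N}$ with $q^nx\equiv y\pmod p$. $K(q,\mathcal{A}):=\{\sum_{i=1}^\infty d_i q^{ -i}: d_i\in\mathcal{A}\ \forall i\in\mathbb{N}\}$. -}

module Defs where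

open import Data.Nat as ℕ using (ℕ; zero; suc; _^_; _≤_; _<_; NonZero)
open import Data.Nat.Properties using (m^n≢0)
open import Data.Nat.GCD using (gcd)
open import Data.Fin using (Fin; toℕ)
open import Data.Fin.Subset using (Subset; _∈_)
open import Data.Integer as ℤ using (ℤ; +_)
open import Data.Integer.Divisibility using () renaming (_∣_ to _∣ℤ_)
open import Data.Rational as ℚ using (ℚ; _/_; 0ℚ)
open import Data.Product using (Σ; ∃; _×_)
open import Relation.Binary.PropositionalEquality using (_≡_)

InZpStar : ℕ → ℕ → Set
InZpStar p n = (1 ≤ n) × (n ≤ p) × (gcd n p ≡ 1)

_∼[_]_mod_ : ℕ → ℕ → ℕ → ℕ → Set
x ∼[ q ] y mod p = ∃ λ (n : ℕ) → (+ p) ∣ℤ ((+ (q ^ n ℕ.* x)) ℤ.- (+ y))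

partialSum : (q : ℕ) .{{_ : NonZero q}} → (ℕ → ℕ) → ℕ → ℚ
partialSum q d zero = 0ℚ
partialSum q d (suc n) =
  partialSum q d n ℚ.+ _/_ (+ d (suc n)) (q ^ suc n) {{m^n≢0 q (suc n)}}

SeriesSumsTo : (q : ℕ) .{{_ : NonZero q}} → (ℕ → ℕ) → ℚ → Set
SeriesSumsTo q d r =
  ∀ (ε : ℚ) → 0ℚ ℚ.< ε → ∃ λ (N : ℕ) → ∀ (n : ℕ) → N ≤ n →
    ℚ.∣ partialSum q d n ℚ.- r ∣ ℚ.≤ ε

InK : (q : ℕ) .{{_ : NonZero q}} → Subset q → ℚ → Set
InK q A r = Σ (ℕ → Fin q) λ d → (∀ i → d i ∈ A) × SeriesSumsTo q (λ i → toℕ (d i)) r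

-- If x/p = Σ dᵢ q⁻ⁱ, shifting the digit sequence by n gives a digit series,
-- hence a number in [0,1], equal to q^n x/p − N with N = Σ_{i≤n} dᵢ q^{n−i} an
-- integer. As q^n x ≡ y (mod p), it differs from y/p by an integer, and 0 < y < p
-- forces it to be y/p. For the converse, ∼_q is symmetric: by pigeonhole on the
-- residues of q^k and coprimality, q^T ≡ 1 (mod p) for some T ≥ 1, so q^{(T−1)n}
-- undoes q^n.
{-# OPTIONS --safe #-}
module Submission where

open import Defs
open import Data.Nat using (ℕ; _≤_; _<_; NonZero)
open import Data.Nat.GCD using (gcd)
open import Data.Fin.Subset using (Subset; ∣_∣)
open import Data.Integer using (+_)
open import Data.Rational using (_/_)
open import Function.Bundles using (_⇔_; mk⇔)

open import Data.Nat as ℕ using (zero; suc; _^_)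
import Data.Nat.Properties as ℕP
open import Data.Nat.Divisibility using (_∣_; >⇒∤; ∣-refl; ∣1⇒≡1)
open import Data.Nat.GCD using (gcd-greatest)
open import Data.Nat.DivMod using (_%_; m≡m%n+[m/n]*n; m%n<n) renaming (_/_ to _div_)
open import Data.Nat.Coprimality using (Coprime; coprime-divisor; gcd≡1⇒coprime)
import Data.Nat.Tactic.RingSolver as ℕ-Ring
open import Data.Integer as ℤ using (1ℤ)
import Data.Integer.Properties as ℤP
open import Data.Integer.Divisibility.Signed as Signed
  using (∣ᵤ⇒∣; ∣⇒∣ᵤ; ∣m∣n⇒∣m-n; ∣m∣n⇒∣m+n; ∣m⇒∣m*n; ∣n⇒∣m*n) renaming (_∣_ to _∣ℤ_)
import Data.Integer.Tactic.RingSolver as ℤ-Ring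
open import Data.Rational as ℚ using (ℚ; 0ℚ; 1ℚ; Positive; toℚᵘ; fromℚᵘ)
import Data.Rational.Properties as ℚP
open import Data.Rational.Solver using (module +-*-Solver)
import Data.Rational.Unnormalised as ℚᵘ
import Data.Rational.Unnormalised.Properties as ℚᵘP
open import Data.Fin using (toℕ; fromℕ<)
import Data.Fin.Properties as FinP
open import Data.Product using (∃; _,_; proj₁)
open import Data.Sum using (_⊎_; inj₁; inj₂)
open import Relation.Nullary using (yes; no; contradiction)
open import Relation.Binary.PropositionalEquality
  using (_≡_; refl; sym; trans; cong; cong₂; subst; subst₂; module ≡-Reasoning)

*≡*⇒/≡/ : ∀ a b c e .{{_ : NonZero b}} .{{_ : NonZero e}} →
  a ℕ.* e ≡ c ℕ.* b → + a / b ≡ + c / e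
*≡*⇒/≡/ a (suc b) c (suc e) eq = ℚP.fromℚᵘ-cong {ℚᵘ.mkℚᵘ (+ a) b} {ℚᵘ.mkℚᵘ (+ c) e}
  (ℚᵘ.*≡* (trans (sym (ℤP.pos-* a (suc e))) (trans (cong +_ eq) (ℤP.pos-* c (suc b)))))

/≤/⇒*≤* : ∀ a b c e .{{_ : NonZero b}} .{{_ : NonZero e}} →
  + a / b ℚ.≤ + c / e → a ℕ.* e ℕ.≤ c ℕ.* b
/≤/⇒*≤* a (suc b) c (suc e) le
  with ℚᵘP.≤-respʳ-≃ (ℚP.toℚᵘ-fromℚᵘ (ℚᵘ.mkℚᵘ (+ c) e))
         (ℚᵘP.≤-respˡ-≃ (ℚP.toℚᵘ-fromℚᵘ (ℚᵘ.mkℚᵘ (+ a) b)) (ℚP.toℚᵘ-mono-≤ le))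
... | ℚᵘ.*≤* h = ℤP.drop‿+≤+ (subst₂ ℤ._≤_ (sym (ℤP.pos-* a (suc e))) (sym (ℤP.pos-* c (suc b))) h)

*≤*⇒/≤/ : ∀ a b c e .{{_ : NonZero b}} .{{_ : NonZero e}} →
  a ℕ.* e ℕ.≤ c ℕ.* b → + a / b ℚ.≤ + c / e
*≤*⇒/≤/ a (suc b) c (suc e) le = ℚP.toℚᵘ-cancel-≤
  (ℚᵘP.≤-respʳ-≃ (ℚᵘP.≃-sym (ℚP.toℚᵘ-fromℚᵘ (ℚᵘ.mkℚᵘ (+ c) e)))
    (ℚᵘP.≤-respˡ-≃ (ℚᵘP.≃-sym (ℚP.toℚᵘ-fromℚᵘ (ℚᵘ.mkℚᵘ (+ a) b)))
      (ℚᵘ.*≤* (subst₂ ℤ._≤_ (ℤP.pos-* a (suc e)) (ℤP.pos-* c (suc b)) (ℤ.+≤+ le)))))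

/+/≡ : ∀ a b c e .{{_ : NonZero b}} .{{_ : NonZero e}} →
  + a / b ℚ.+ + c / e ≡ _/_ (+ (a ℕ.* e ℕ.+ c ℕ.* b)) (b ℕ.* e) {{ℕP.m*n≢0 b e}}
/+/≡ a (suc b) c (suc e) = ℚP.toℚᵘ-injective (begin
  toℚᵘ (+ a / suc b ℚ.+ + c / suc e)          ≈⟨ ℚP.toℚᵘ-homo-+ (+ a / suc b) (+ c / suc e) ⟩
  toℚᵘ (+ a / suc b) ℚᵘ.+ toℚᵘ (+ c / suc e)  ≈⟨ ℚᵘP.+-cong (ℚP.toℚᵘ-fromℚᵘ A) (ℚP.toℚᵘ-fromℚᵘ C) ⟩
  A ℚᵘ.+ C                                    ≈⟨ ℚᵘP.≃-sym (ℚP.toℚᵘ-fromℚᵘ (A ℚᵘ.+ C)) ⟩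
  toℚᵘ (fromℚᵘ (A ℚᵘ.+ C))                    ≡⟨ cong toℚᵘ (ℚP./-cong numerator refl) ⟩
  toℚᵘ (+ (a ℕ.* suc e ℕ.+ c ℕ.* suc b) / (suc b ℕ.* suc e)) ∎)
  where
  open ℚᵘP.≃-Reasoning
  A = ℚᵘ.mkℚᵘ (+ a) b
  C = ℚᵘ.mkℚᵘ (+ c) e
  numerator : + a ℤ.* + suc e ℤ.+ + c ℤ.* + suc b ≡ + (a ℕ.* suc e ℕ.+ c ℕ.* suc b)
  numerator = sym (trans (ℤP.pos-+ (a ℕ.* suc e) _)
                         (cong₂ ℤ._+_ (ℤP.pos-* a (suc e)) (ℤP.pos-* c (suc b))))

/*/≡ : ∀ a b c e .{{_ : NonZero b}} .{{_ : NonZero e}} →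
  (+ a / b) ℚ.* (+ c / e) ≡ _/_ (+ (a ℕ.* c)) (b ℕ.* e) {{ℕP.m*n≢0 b e}}
/*/≡ a (suc b) c (suc e) = ℚP.toℚᵘ-injective (begin
  toℚᵘ ((+ a / suc b) ℚ.* (+ c / suc e))      ≈⟨ ℚP.toℚᵘ-homo-* (+ a / suc b) (+ c / suc e) ⟩
  toℚᵘ (+ a / suc b) ℚᵘ.* toℚᵘ (+ c / suc e)  ≈⟨ ℚᵘP.*-cong (ℚP.toℚᵘ-fromℚᵘ A) (ℚP.toℚᵘ-fromℚᵘ C) ⟩
  A ℚᵘ.* C                                    ≈⟨ ℚᵘP.≃-sym (ℚP.toℚᵘ-fromℚᵘ (A ℚᵘ.* C)) ⟩
  toℚᵘ (fromℚᵘ (A ℚᵘ.* C))                    ≡⟨ cong toℚᵘ (ℚP./-cong (sym (ℤP.pos-* a c)) refl) ⟩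
  toℚᵘ (+ (a ℕ.* c) / (suc b ℕ.* suc e))      ∎)
  where
  open ℚᵘP.≃-Reasoning
  A = ℚᵘ.mkℚᵘ (+ a) b
  C = ℚᵘ.mkℚᵘ (+ c) e

-- SeriesSumsTo q d r unfolds to partialSum q d ⟶ r.
infix 4 _⟶_
_⟶_ : (ℕ → ℚ) → ℚ → Set
s ⟶ L = ∀ (ε : ℚ) → 0ℚ ℚ.< ε → ∃ λ (N : ℕ) → ∀ (n : ℕ) → N ℕ.≤ n → ℚ.∣ s n ℚ.- L ∣ ℚ.≤ ε

open +-*-Solver using (solve; _:+_; _:*_; _:-_; :-_; _:=_)

p≤∣p∣ : ∀ p → p ℚ.≤ ℚ.∣ p ∣
p≤∣p∣ p with ℚP.≤-total 0ℚ p
... | inj₁ 0≤p = ℚP.≤-reflexive (sym (ℚP.0≤p⇒∣p∣≡p 0≤p))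
... | inj₂ p≤0 = ℚP.≤-trans p≤0 (ℚP.0≤∣p∣ p)

-p≤∣p∣ : ∀ p → ℚ.- p ℚ.≤ ℚ.∣ p ∣
-p≤∣p∣ p = subst (ℚ.- p ℚ.≤_) (ℚP.∣-p∣≡∣p∣ p) (p≤∣p∣ (ℚ.- p))

∣p-q∣≤ε⇒p≤q+ε : ∀ {p q ε} → ℚ.∣ p ℚ.- q ∣ ℚ.≤ ε → p ℚ.≤ q ℚ.+ ε
∣p-q∣≤ε⇒p≤q+ε {p} {q} {ε} h = begin
  p                   ≡⟨ solve 2 (λ p q → p := q :+ (p :- q)) refl p q ⟩
  q ℚ.+ (p ℚ.- q)     ≤⟨ ℚP.+-monoʳ-≤ q (ℚP.≤-trans (p≤∣p∣ (p ℚ.- q)) h) ⟩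
  q ℚ.+ ε             ∎
  where open ℚP.≤-Reasoning

∣p-q∣≤ε⇒q≤p+ε : ∀ {p q ε} → ℚ.∣ p ℚ.- q ∣ ℚ.≤ ε → q ℚ.≤ p ℚ.+ ε
∣p-q∣≤ε⇒q≤p+ε {p} {q} {ε} h = begin
  q                     ≡⟨ solve 2 (λ p q → q := p :+ (:- (p :- q))) refl p q ⟩
  p ℚ.+ ℚ.- (p ℚ.- q)   ≤⟨ ℚP.+-monoʳ-≤ p (ℚP.≤-trans (-p≤∣p∣ (p ℚ.- q)) h) ⟩
  p ℚ.+ ε               ∎
  where open ℚP.≤-Reasoning

≤+ε⇒≤ : ∀ {p q} → (∀ ε → 0ℚ ℚ.< ε → p ℚ.≤ q ℚ.+ ε) → p ℚ.≤ q
≤+ε⇒≤ {p} {q} h with p ℚP.≤? q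
... | yes p≤q = p≤q
... | no p≰q with ℚP.<-dense (ℚP.≰⇒> p≰q)
... | r , q<r , r<p = contradiction (ℚP.≤-<-trans p≤r r<p) (ℚP.<-irrefl refl)
  where
  p≤r : p ℚ.≤ r
  p≤r = subst (p ℚ.≤_) (solve 2 (λ q r → q :+ (r :- q) := r) refl q r)
          (h (r ℚ.- q) (subst (ℚ._< r ℚ.- q) (ℚP.+-inverseʳ q) (ℚP.+-monoˡ-< (ℚ.- q) q<r)))

≤-limit : ∀ {s L c} → (∀ k → c ℚ.≤ s k) → s ⟶ L → c ℚ.≤ L
≤-limit c≤s s⟶L = ≤+ε⇒≤ λ ε ε>0 → let N , conv = s⟶L ε ε>0 in
  ℚP.≤-trans (c≤s N) (∣p-q∣≤ε⇒p≤q+ε (conv N ℕP.≤-refl))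

limit-≤ : ∀ {s L c} → (∀ k → s k ℚ.≤ c) → s ⟶ L → L ℚ.≤ c
limit-≤ {s} s≤c s⟶L = ≤+ε⇒≤ λ ε ε>0 → let N , conv = s⟶L ε ε>0 in
  ℚP.≤-trans (∣p-q∣≤ε⇒q≤p+ε {s N} (conv N ℕP.≤-refl)) (ℚP.+-monoˡ-≤ ε (s≤c N))

⟶-cong : ∀ {s t L} → (∀ k → s k ≡ t k) → s ⟶ L → t ⟶ L
⟶-cong s≡t s⟶L ε ε>0 = let N , conv = s⟶L ε ε>0 in
  N , λ k N≤k → subst (λ u → ℚ.∣ u ℚ.- _ ∣ ℚ.≤ ε) (s≡t k) (conv k N≤k)

⟶-tail : ∀ {s L} n → s ⟶ L → (λ k → s (k ℕ.+ n)) ⟶ L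
⟶-tail n s⟶L ε ε>0 = let N , conv = s⟶L ε ε>0 in
  N , λ k N≤k → conv (k ℕ.+ n) (ℕP.≤-trans N≤k (ℕP.m≤m+n k n))

⟶-*ˡ : ∀ {s L} a .{{_ : Positive a}} → s ⟶ L → (λ k → a ℚ.* s k) ⟶ a ℚ.* L
⟶-*ˡ {s} {L} a s⟶L ε ε>0 = let N , conv = s⟶L (ε ℚ.* a⁻¹) ε/a>0 in N , λ k N≤k → begin
  ℚ.∣ a ℚ.* s k ℚ.- a ℚ.* L ∣
    ≡⟨ cong ℚ.∣_∣ (solve 3 (λ a x l → a :* x :- a :* l := a :* (x :- l)) refl a (s k) L) ⟩
  ℚ.∣ a ℚ.* (s k ℚ.- L) ∣
    ≡⟨ ℚP.∣p*q∣≡∣p∣*∣q∣ a (s k ℚ.- L) ⟩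
  ℚ.∣ a ∣ ℚ.* ℚ.∣ s k ℚ.- L ∣
    ≡⟨ cong (ℚ._* ℚ.∣ s k ℚ.- L ∣) (ℚP.0≤p⇒∣p∣≡p (ℚP.<⇒≤ (ℚP.positive⁻¹ a))) ⟩
  a ℚ.* ℚ.∣ s k ℚ.- L ∣
    ≤⟨ ℚP.*-monoˡ-≤-nonNeg a {{ℚP.pos⇒nonNeg a}} (conv k N≤k) ⟩
  a ℚ.* (ε ℚ.* a⁻¹)
    ≡⟨ solve 3 (λ a e b → a :* (e :* b) := e :* (a :* b)) refl a ε a⁻¹ ⟩
  ε ℚ.* (a ℚ.* a⁻¹)
    ≡⟨ cong (ε ℚ.*_) (ℚP.*-inverseʳ a {{ℚP.pos⇒nonZero a}}) ⟩
  ε ℚ.* 1ℚ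
    ≡⟨ ℚP.*-identityʳ ε ⟩
  ε ∎
  where
  open ℚP.≤-Reasoning
  a⁻¹ = ℚ.1/_ a {{ℚP.pos⇒nonZero a}}
  ε/a>0 : 0ℚ ℚ.< ε ℚ.* a⁻¹
  ε/a>0 = ℚP.positive⁻¹ _ {{ℚP.pos*pos⇒pos ε {{ℚ.positive ε>0}} a⁻¹ {{ℚP.1/pos⇒pos a}}}}

⟶-cancelˡ-+ : ∀ {s L} c → (λ k → c ℚ.+ s k) ⟶ c ℚ.+ L → s ⟶ L
⟶-cancelˡ-+ {s} {L} c c+s⟶c+L ε ε>0 = let N , conv = c+s⟶c+L ε ε>0 in
  N , λ k N≤k → subst (ℚ._≤ ε)
    (cong ℚ.∣_∣ (solve 3 (λ c x l → (c :+ x) :- (c :+ l) := x :- l) refl c (s k) L)) (conv k N≤k)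

<∧∣⇒≡0 : ∀ {m n} → m < n → n ∣ m → m ≡ 0
<∧∣⇒≡0 {zero}  _   _   = refl
<∧∣⇒≡0 {suc m} m<n n∣m = contradiction n∣m (>⇒∤ m<n)

∣[r-y]⇒r≡y : ∀ {p r y} .{{_ : NonZero p}} → r ≤ p → 0 < y → y < p →
  (+ p) ∣ℤ (+ r ℤ.- + y) → r ≡ y
∣[r-y]⇒r≡y {p} {r} {y} r≤p 0<y y<p p∣r-y = by-cases (ℕP.≤-total r y)
  where
  p∣∣r⊖y∣ : p ∣ ℤ.∣ r ℤ.⊖ y ∣
  p∣∣r⊖y∣ = subst (λ z → p ∣ ℤ.∣ z ∣) (ℤP.[+m]-[+n]≡m⊖n r y) (∣⇒∣ᵤ p∣r-y)
  by-cases : r ≤ y ⊎ y ≤ r → r ≡ y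
  by-cases (inj₁ r≤y) = ℕP.≤-antisym r≤y (ℕP.m∸n≡0⇒m≤n (<∧∣⇒≡0
    (ℕP.≤-<-trans (ℕP.m∸n≤m y r) y<p)
    (subst (p ∣_) (ℤP.∣⊖∣-≤ r≤y) p∣∣r⊖y∣)))
  by-cases (inj₂ y≤r) = ℕP.≤-antisym (ℕP.m∸n≡0⇒m≤n (<∧∣⇒≡0
    (ℕP.m<n+o⇒m∸n<o r y (ℕP.≤-<-trans r≤p (ℕP.m<n+m p 0<y)))
    (subst (p ∣_) (trans (ℤP.∣m⊖n∣≡∣n⊖m∣ r y) (ℤP.∣⊖∣-≤ y≤r)) p∣∣r⊖y∣))) y≤r

∣[w-y]⇒w≡I*p+y : ∀ {p w y I} .{{_ : NonZero p}} → I ℕ.* p ≤ w → w ≤ I ℕ.* p ℕ.+ p →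
  0 < y → y < p → (+ p) ∣ℤ (+ w ℤ.- + y) → w ≡ I ℕ.* p ℕ.+ y
∣[w-y]⇒w≡I*p+y {p} {w} {y} {I} Ip≤w w≤Ip+p 0<y y<p p∣w-y = begin
  w              ≡⟨ sym (ℕP.m+[n∸m]≡n Ip≤w) ⟩
  I ℕ.* p ℕ.+ r  ≡⟨ cong (I ℕ.* p ℕ.+_) (∣[r-y]⇒r≡y r≤p 0<y y<p p∣r-y) ⟩
  I ℕ.* p ℕ.+ y  ∎
  where
  open ≡-Reasoning
  r = w ℕ.∸ I ℕ.* p
  r≤p : r ≤ p
  r≤p = subst (r ≤_) (ℕP.m+n∸m≡n (I ℕ.* p) p) (ℕP.∸-monoˡ-≤ (I ℕ.* p) w≤Ip+p)
  +w≡ : + w ≡ + I ℤ.* + p ℤ.+ + r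
  +w≡ = trans (cong +_ (sym (ℕP.m+[n∸m]≡n Ip≤w)))
          (trans (ℤP.pos-+ (I ℕ.* p) r) (cong (ℤ._+ + r) (ℤP.pos-* I p)))
  cancel : ∀ a b c → ((a ℤ.+ b) ℤ.- c) ℤ.- a ≡ b ℤ.- c
  cancel = ℤ-Ring.solve-∀
  p∣r-y : (+ p) ∣ℤ (+ r ℤ.- + y)
  p∣r-y = subst ((+ p) ∣ℤ_)
    (trans (cong (λ z → (z ℤ.- + y) ℤ.- + I ℤ.* + p) +w≡) (cancel (+ I ℤ.* + p) (+ r) (+ y)))
    (∣m∣n⇒∣m-n p∣w-y (∣n⇒∣m*n (+ I) Signed.∣-refl))

w/p≡I+y/p : ∀ {p w y I} .{{_ : NonZero p}} → 0 < y → y < p → (+ p) ∣ℤ (+ w ℤ.- + y) →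
  + I / 1 ℚ.≤ + w / p → + w / p ℚ.≤ + I / 1 ℚ.+ 1ℚ → + w / p ≡ + I / 1 ℚ.+ + y / p
w/p≡I+y/p {p} {w} {y} {I} {{p≢0}} 0<y y<p p∣w-y I≤w/p w/p≤I+1 = begin
  + w / p
    ≡⟨ cong (λ z → + z / p) (∣[w-y]⇒w≡I*p+y {p} {w} {y} {I} Ip≤w w≤Ip+p 0<y y<p p∣w-y) ⟩
  + (I ℕ.* p ℕ.+ y) / p
    ≡⟨ *≡*⇒/≡/ (I ℕ.* p ℕ.+ y) p (I ℕ.* p ℕ.+ y ℕ.* 1) (1 ℕ.* p) {{p≢0}} {{ℕP.m*n≢0 1 p}} (cross I p y) ⟩
  _/_ (+ (I ℕ.* p ℕ.+ y ℕ.* 1)) (1 ℕ.* p) {{ℕP.m*n≢0 1 p}}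
    ≡⟨ sym (/+/≡ I 1 y p) ⟩
  + I / 1 ℚ.+ + y / p ∎
  where
  open ≡-Reasoning
  cross : ∀ I p y → (I ℕ.* p ℕ.+ y) ℕ.* (1 ℕ.* p) ≡ (I ℕ.* p ℕ.+ y ℕ.* 1) ℕ.* p
  cross = ℕ-Ring.solve-∀
  expand : ∀ I p → (I ℕ.* 1 ℕ.+ 1 ℕ.* 1) ℕ.* p ≡ I ℕ.* p ℕ.+ p
  expand = ℕ-Ring.solve-∀
  Ip≤w : I ℕ.* p ≤ w
  Ip≤w = subst (I ℕ.* p ≤_) (ℕP.*-identityʳ w) (/≤/⇒*≤* I 1 w p I≤w/p)
  w≤Ip+p : w ≤ I ℕ.* p ℕ.+ p
  w≤Ip+p = subst₂ _≤_ (ℕP.*-identityʳ w) (expand I p)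
    (/≤/⇒*≤* w p (I ℕ.* 1 ℕ.+ 1 ℕ.* 1) 1 (subst (+ w / p ℚ.≤_) (/+/≡ I 1 1 1) w/p≤I+1))

-- Symmetry of ∼_q for q coprime to p

%≡%⇒∣[m-n] : ∀ {m n p} .{{_ : NonZero p}} → m % p ≡ n % p → (+ p) ∣ℤ (+ m ℤ.- + n)
%≡%⇒∣[m-n] {m} {n} {p} m%p≡n%p = Signed.divides (+ (m div p) ℤ.- + (n div p)) (begin
  + m ℤ.- + n
    ≡⟨ cong₂ ℤ._-_ (split m) (split n) ⟩
  (+ (m % p) ℤ.+ + (m div p) ℤ.* + p) ℤ.- (+ (n % p) ℤ.+ + (n div p) ℤ.* + p)
    ≡⟨ cong (λ r → (+ r ℤ.+ + (m div p) ℤ.* + p) ℤ.- (+ (n % p) ℤ.+ + (n div p) ℤ.* + p)) m%p≡n%p ⟩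
  (+ (n % p) ℤ.+ + (m div p) ℤ.* + p) ℤ.- (+ (n % p) ℤ.+ + (n div p) ℤ.* + p)
    ≡⟨ cancel (+ (n % p)) (+ (m div p)) (+ (n div p)) (+ p) ⟩
  (+ (m div p) ℤ.- + (n div p)) ℤ.* + p ∎)
  where
  open ≡-Reasoning
  split : ∀ k → + k ≡ + (k % p) ℤ.+ + (k div p) ℤ.* + p
  split k = trans (cong +_ (m≡m%n+[m/n]*n k p))
              (trans (ℤP.pos-+ (k % p) _) (cong (ℤ._+_ (+ (k % p))) (ℤP.pos-* (k div p) p)))
  cancel : ∀ r a b p → (r ℤ.+ a ℤ.* p) ℤ.- (r ℤ.+ b ℤ.* p) ≡ (a ℤ.- b) ℤ.* p
  cancel = ℤ-Ring.solve-∀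

coprime-^-divisor : ∀ {p q m} a → Coprime p q → p ∣ q ^ a ℕ.* m → p ∣ m
coprime-^-divisor {p} {m = m} zero    _   p∣m       = subst (p ∣_) (ℕP.+-identityʳ m) p∣m
coprime-^-divisor {p} {q} {m} (suc a) p⊥q p∣q^a*m = coprime-^-divisor a p⊥q
  (coprime-divisor p⊥q (subst (p ∣_) (ℕP.*-assoc q (q ^ a) m) p∣q^a*m))

coprime-^-divisorℤ : ∀ {p q z} a → Coprime p q → (+ p) ∣ℤ (+ (q ^ a) ℤ.* z) → (+ p) ∣ℤ z
coprime-^-divisorℤ {p} {q} {z} a p⊥q p∣q^a*z = ∣ᵤ⇒∣ (coprime-^-divisor a p⊥q
  (subst (p ∣_) (ℤP.abs-* (+ (q ^ a)) z) (∣⇒∣ᵤ p∣q^a*z)))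

power-period : ∀ p .{{_ : NonZero p}} q → Coprime p q →
  ∃ λ T → (+ p) ∣ℤ (+ (q ^ suc T) ℤ.- 1ℤ)
power-period p q p⊥q with FinP.pigeonhole (ℕP.n<1+n p) (λ i → fromℕ< (m%n<n (q ^ toℕ i) p))
... | i , j , i<j , residues≡ =
  T , coprime-^-divisorℤ a p⊥q (subst ((+ p) ∣ℤ_) factor (%≡%⇒∣[m-n] (sym a%≡b%)))
  where
  open ≡-Reasoning
  a = toℕ i
  b = toℕ j
  T = b ℕ.∸ suc a
  a%≡b% : q ^ a % p ≡ q ^ b % p
  a%≡b% = trans (sym (FinP.toℕ-fromℕ< _)) (trans (cong toℕ residues≡) (FinP.toℕ-fromℕ< _))
  b≡ : b ≡ a ℕ.+ suc T
  b≡ = sym (trans (ℕP.+-suc a T) (ℕP.m+[n∸m]≡n i<j))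
  distribute : ∀ x y → x ℤ.* y ℤ.- x ≡ x ℤ.* (y ℤ.- 1ℤ)
  distribute = ℤ-Ring.solve-∀
  factor : + (q ^ b) ℤ.- + (q ^ a) ≡ + (q ^ a) ℤ.* (+ (q ^ suc T) ℤ.- 1ℤ)
  factor = begin
    + (q ^ b) ℤ.- + (q ^ a)                    ≡⟨ cong (λ e → + (q ^ e) ℤ.- + (q ^ a)) b≡ ⟩
    + (q ^ (a ℕ.+ suc T)) ℤ.- + (q ^ a)        ≡⟨ cong (λ z → + z ℤ.- + (q ^ a)) (ℕP.^-distribˡ-+-* q a (suc T)) ⟩
    + (q ^ a ℕ.* q ^ suc T) ℤ.- + (q ^ a)      ≡⟨ cong (ℤ._- + (q ^ a)) (ℤP.pos-* (q ^ a) (q ^ suc T)) ⟩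
    + (q ^ a) ℤ.* + (q ^ suc T) ℤ.- + (q ^ a)  ≡⟨ distribute (+ (q ^ a)) (+ (q ^ suc T)) ⟩
    + (q ^ a) ℤ.* (+ (q ^ suc T) ℤ.- 1ℤ)       ∎

∣[a-1]⇒∣[a^n-1] : ∀ {p} a → (+ p) ∣ℤ (+ a ℤ.- 1ℤ) → ∀ n → (+ p) ∣ℤ (+ (a ^ n) ℤ.- 1ℤ)
∣[a-1]⇒∣[a^n-1] {p} a p∣a-1 zero    = Signed.divides (+ 0) (sym (ℤP.*-zeroˡ (+ p)))
∣[a-1]⇒∣[a^n-1] {p} a p∣a-1 (suc n) = subst ((+ p) ∣ℤ_) (sym expand)
  (∣m∣n⇒∣m+n (∣n⇒∣m*n (+ a) (∣[a-1]⇒∣[a^n-1] a p∣a-1 n)) p∣a-1)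
  where
  regroup : ∀ x y → x ℤ.* y ℤ.- 1ℤ ≡ x ℤ.* (y ℤ.- 1ℤ) ℤ.+ (x ℤ.- 1ℤ)
  regroup = ℤ-Ring.solve-∀
  expand : + (a ^ suc n) ℤ.- 1ℤ ≡ + a ℤ.* (+ (a ^ n) ℤ.- 1ℤ) ℤ.+ (+ a ℤ.- 1ℤ)
  expand = trans (cong (ℤ._- 1ℤ) (ℤP.pos-* a (a ^ n))) (regroup (+ a) (+ (a ^ n)))

periodic-∼-sym : ∀ {p q x y} T → (+ p) ∣ℤ (+ (q ^ suc T) ℤ.- 1ℤ) →
  x ∼[ q ] y mod p → y ∼[ q ] x mod p
periodic-∼-sym {p} {q} {x} {y} T p∣q^[1+T]-1 (n , p∣q^n*x-y) = m , ∣⇒∣ᵤ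
  (subst ((+ p) ∣ℤ_) (sym identity)
    (∣m∣n⇒∣m-n (∣m⇒∣m*n (+ x) p∣q^[n+m]-1) (∣n⇒∣m*n (+ (q ^ m)) (∣ᵤ⇒∣ p∣q^n*x-y))))
  where
  open ≡-Reasoning
  m = T ℕ.* n
  p∣q^[n+m]-1 : (+ p) ∣ℤ (+ (q ^ n ℕ.* q ^ m) ℤ.- 1ℤ)
  p∣q^[n+m]-1 = subst (λ k → (+ p) ∣ℤ (+ k ℤ.- 1ℤ))
    (trans (ℕP.^-*-assoc q (suc T) n) (ℕP.^-distribˡ-+-* q n m))
    (∣[a-1]⇒∣[a^n-1] (q ^ suc T) p∣q^[1+T]-1 n)
  regroup : ∀ u v x y → v ℤ.* y ℤ.- x ≡ (u ℤ.* v ℤ.- 1ℤ) ℤ.* x ℤ.- v ℤ.* (u ℤ.* x ℤ.- y)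
  regroup = ℤ-Ring.solve-∀
  identity : + (q ^ m ℕ.* y) ℤ.- + x
           ≡ (+ (q ^ n ℕ.* q ^ m) ℤ.- 1ℤ) ℤ.* + x ℤ.- + (q ^ m) ℤ.* (+ (q ^ n ℕ.* x) ℤ.- + y)
  identity = begin
    + (q ^ m ℕ.* y) ℤ.- + x
      ≡⟨ cong (ℤ._- + x) (ℤP.pos-* (q ^ m) y) ⟩
    + (q ^ m) ℤ.* + y ℤ.- + x
      ≡⟨ regroup (+ (q ^ n)) (+ (q ^ m)) (+ x) (+ y) ⟩
    (+ (q ^ n) ℤ.* + (q ^ m) ℤ.- 1ℤ) ℤ.* + x ℤ.- + (q ^ m) ℤ.* (+ (q ^ n) ℤ.* + x ℤ.- + y)
      ≡⟨ sym (cong₂ (λ u v → (u ℤ.- 1ℤ) ℤ.* + x ℤ.- + (q ^ m) ℤ.* (v ℤ.- + y))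
                    (ℤP.pos-* (q ^ n) (q ^ m)) (ℤP.pos-* (q ^ n) x)) ⟩
    (+ (q ^ n ℕ.* q ^ m) ℤ.- 1ℤ) ℤ.* + x ℤ.- + (q ^ m) ℤ.* (+ (q ^ n ℕ.* x) ℤ.- + y) ∎

∼-sym : ∀ {p q x y} .{{_ : NonZero p}} → Coprime p q → x ∼[ q ] y mod p → y ∼[ q ] x mod p
∼-sym {p} {q} {x} {y} p⊥q = let T , p∣q^[1+T]-1 = power-period p q p⊥q in
  periodic-∼-sym {p} {q} {x} {y} T p∣q^[1+T]-1

InZpStar⇒< : ∀ {p y} → 2 ≤ p → InZpStar p y → y < p
InZpStar⇒< {p} 2≤p (_ , y≤p , gcd[y,p]≡1) = ℕP.≤∧≢⇒< y≤p λ { refl →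
  ℕP.<⇒≢ 2≤p (sym (∣1⇒≡1 (subst (p ∣_) gcd[y,p]≡1 (gcd-greatest ∣-refl ∣-refl)))) }

-- Base-q expansions

module Expansion (q : ℕ) .{{_ : NonZero q}} where

  private
    q^≢0 : ∀ k → NonZero (q ^ k)
    q^≢0 k = ℕP.m^n≢0 q k

  _/q^_ : ℕ → ℕ → ℚ
  a /q^ k = _/_ (+ a) (q ^ k) {{q^≢0 k}}

  qℚ^_ : ℕ → ℚ
  qℚ^ n = + (q ^ n) / 1

  numerator : (ℕ → ℕ) → ℕ → ℕ
  numerator d zero    = 0
  numerator d (suc k) = numerator d k ℕ.* q ℕ.+ d (suc k)

  partialSum≡numerator/q^ : ∀ d k → partialSum q d k ≡ numerator d k /q^ k
  partialSum≡numerator/q^ d zero    = refl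
  partialSum≡numerator/q^ d (suc k) = begin
    partialSum q d k ℚ.+ c /q^ suc k
      ≡⟨ cong (ℚ._+ c /q^ suc k) (partialSum≡numerator/q^ d k) ⟩
    N /q^ k ℚ.+ c /q^ suc k
      ≡⟨ /+/≡ N (q ^ k) c (q ^ suc k) {{q^≢0 k}} {{q^≢0 (suc k)}} ⟩
    _/_ (+ (N ℕ.* q ^ suc k ℕ.+ c ℕ.* q ^ k)) (q ^ k ℕ.* q ^ suc k) {{q^k*q^[1+k]≢0}}
      ≡⟨ *≡*⇒/≡/ (N ℕ.* q ^ suc k ℕ.+ c ℕ.* q ^ k) (q ^ k ℕ.* q ^ suc k) (N ℕ.* q ℕ.+ c) (q ^ suc k)
                 {{q^k*q^[1+k]≢0}} {{q^≢0 (suc k)}} (cross N c q (q ^ k)) ⟩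
    (N ℕ.* q ℕ.+ c) /q^ suc k ∎
    where
    open ≡-Reasoning
    N = numerator d k
    c = d (suc k)
    q^k*q^[1+k]≢0 = ℕP.m*n≢0 (q ^ k) (q ^ suc k) {{q^≢0 k}} {{q^≢0 (suc k)}}
    cross : ∀ N c q Q → (N ℕ.* (q ℕ.* Q) ℕ.+ c ℕ.* Q) ℕ.* (q ℕ.* Q) ≡ (N ℕ.* q ℕ.+ c) ℕ.* (Q ℕ.* (q ℕ.* Q))
    cross = ℕ-Ring.solve-∀

  numerator<q^ : ∀ {d} → (∀ i → d i < q) → ∀ k → numerator d k < q ^ k
  numerator<q^ d<q zero        = ℕ.s≤s ℕ.z≤n
  numerator<q^ {d} d<q (suc k) = begin-strict
    N ℕ.* q ℕ.+ d (suc k)   <⟨ ℕP.+-monoʳ-< (N ℕ.* q) (d<q (suc k)) ⟩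
    N ℕ.* q ℕ.+ q           ≡⟨ ℕP.+-comm (N ℕ.* q) q ⟩
    suc N ℕ.* q             ≤⟨ ℕP.*-monoˡ-≤ q (numerator<q^ d<q k) ⟩
    q ^ k ℕ.* q             ≡⟨ ℕP.*-comm (q ^ k) q ⟩
    q ^ suc k               ∎
    where
    open ℕP.≤-Reasoning
    N = numerator d k

  0≤partialSum : ∀ d k → 0ℚ ℚ.≤ partialSum q d k
  0≤partialSum d k = subst (0ℚ ℚ.≤_) (sym (partialSum≡numerator/q^ d k))
    (ℚP.nonNegative⁻¹ _ {{ℚP.normalize-nonNeg (numerator d k) (q ^ k) {{q^≢0 k}}}})

  partialSum≤1 : ∀ {d} → (∀ i → d i < q) → ∀ k → partialSum q d k ℚ.≤ 1ℚ
  partialSum≤1 {d} d<q k = subst (ℚ._≤ 1ℚ) (sym (partialSum≡numerator/q^ d k))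
    (*≤*⇒/≤/ (numerator d k) (q ^ k) 1 1 {{q^≢0 k}}
      (subst₂ _≤_ (sym (ℕP.*-identityʳ _)) (sym (ℕP.*-identityˡ _)) (ℕP.<⇒≤ (numerator<q^ d<q k))))

  qℚ^-*-/q^ : ∀ n k c → qℚ^ n ℚ.* c /q^ (k ℕ.+ n) ≡ c /q^ k
  qℚ^-*-/q^ n k c = trans (/*/≡ (q ^ n) 1 c (q ^ (k ℕ.+ n)) {{_}} {{q^≢0 (k ℕ.+ n)}})
    (*≡*⇒/≡/ (q ^ n ℕ.* c) (1 ℕ.* q ^ (k ℕ.+ n)) c (q ^ k)
      {{ℕP.m*n≢0 1 _ {{_}} {{q^≢0 (k ℕ.+ n)}}}} {{q^≢0 k}}
      (trans (cross (q ^ n) c (q ^ k)) (cong (λ z → c ℕ.* (1 ℕ.* z)) (sym (ℕP.^-distribˡ-+-* q k n)))))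
    where
    cross : ∀ a c b → a ℕ.* c ℕ.* b ≡ c ℕ.* (1 ℕ.* (b ℕ.* a))
    cross = ℕ-Ring.solve-∀

  qℚ^-*-/ : ∀ n x p .{{_ : NonZero p}} → qℚ^ n ℚ.* (+ x / p) ≡ + (q ^ n ℕ.* x) / p
  qℚ^-*-/ n x p = trans (/*/≡ (q ^ n) 1 x p)
    (ℚP./-cong {+ (q ^ n ℕ.* x)} {1 ℕ.* p} {{ℕP.m*n≢0 1 p}} refl (ℕP.*-identityˡ p))

  partialSum-shift : ∀ d n k → qℚ^ n ℚ.* partialSum q d (k ℕ.+ n)
    ≡ qℚ^ n ℚ.* partialSum q d n ℚ.+ partialSum q (λ i → d (i ℕ.+ n)) k
  partialSum-shift d n zero    = sym (ℚP.+-identityʳ _)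
  partialSum-shift d n (suc k) = begin
    qℚ^ n ℚ.* (partialSum q d (k ℕ.+ n) ℚ.+ c /q^ suc (k ℕ.+ n))
      ≡⟨ ℚP.*-distribˡ-+ (qℚ^ n) _ _ ⟩
    qℚ^ n ℚ.* partialSum q d (k ℕ.+ n) ℚ.+ qℚ^ n ℚ.* c /q^ suc (k ℕ.+ n)
      ≡⟨ cong₂ ℚ._+_ (partialSum-shift d n k) (qℚ^-*-/q^ n (suc k) c) ⟩
    qℚ^ n ℚ.* partialSum q d n ℚ.+ partialSum q e k ℚ.+ c /q^ suc k
      ≡⟨ ℚP.+-assoc (qℚ^ n ℚ.* partialSum q d n) (partialSum q e k) (c /q^ suc k) ⟩
    qℚ^ n ℚ.* partialSum q d n ℚ.+ partialSum q e (suc k) ∎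
    where
    open ≡-Reasoning
    e = λ i → d (i ℕ.+ n)
    c = d (suc (k ℕ.+ n))

  tail-⟶ : ∀ {d L} n → partialSum q d ⟶ L →
    (λ k → qℚ^ n ℚ.* partialSum q d n ℚ.+ partialSum q (λ i → d (i ℕ.+ n)) k) ⟶ qℚ^ n ℚ.* L
  tail-⟶ {d} n sums = ⟶-cong (partialSum-shift d n)
    (⟶-*ˡ (qℚ^ n) {{ℚP.normalize-pos (q ^ n) 1 {{_}} {{q^≢0 n}}}} (⟶-tail {partialSum q d} n sums))

  ∼⇒InK : ∀ {A p x y} .{{_ : NonZero p}} → x ∼[ q ] y mod p → 0 < y → y < p →
    InK q A (+ x / p) → InK q A (+ y / p)
  ∼⇒InK {A} {p} {x} {y} (n , p∣q^n*x-y) 0<y y<p (d , d∈A , d-sums) =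
    (λ i → d (i ℕ.+ n)) , (λ i → d∈A (i ℕ.+ n)) ,
    ⟶-cancelˡ-+ {tail} H (subst ((λ k → H ℚ.+ tail k) ⟶_) W≡H+y/p (tail-⟶ n d-sums))
    where
    -- The tail sums lie in [0,1] and converge to W − H, where H is an integer.
    open ≡-Reasoning
    digits = λ i → toℕ (d i)
    tail = partialSum q (λ i → digits (i ℕ.+ n))
    H = qℚ^ n ℚ.* partialSum q digits n
    W = qℚ^ n ℚ.* (+ x / p)
    H≤W : H ℚ.≤ W
    H≤W = ≤-limit {λ k → H ℚ.+ tail k}
      (λ k → subst (ℚ._≤ H ℚ.+ tail k) (ℚP.+-identityʳ H) (ℚP.+-monoʳ-≤ H (0≤partialSum _ k)))
      (tail-⟶ n d-sums)
    W≤H+1 : W ℚ.≤ H ℚ.+ 1ℚ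
    W≤H+1 = limit-≤ {λ k → H ℚ.+ tail k}
      (λ k → ℚP.+-monoʳ-≤ H (partialSum≤1 (λ i → FinP.toℕ<n (d (i ℕ.+ n))) k))
      (tail-⟶ n d-sums)
    H≡ : H ≡ + numerator digits n / 1
    H≡ = trans (cong (qℚ^ n ℚ.*_) (partialSum≡numerator/q^ digits n)) (qℚ^-*-/q^ n 0 (numerator digits n))
    W≡ : W ≡ + (q ^ n ℕ.* x) / p
    W≡ = qℚ^-*-/ n x p
    W≡H+y/p : W ≡ H ℚ.+ + y / p
    W≡H+y/p = begin
      W                                    ≡⟨ W≡ ⟩
      + (q ^ n ℕ.* x) / p                  ≡⟨ w/p≡I+y/p {p} {q ^ n ℕ.* x} {y} {numerator digits n} 0<y y<p
                                                (∣ᵤ⇒∣ p∣q^n*x-y) (subst₂ ℚ._≤_ H≡ W≡ H≤W)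
                                                (subst₂ ℚ._≤_ W≡ (cong (ℚ._+ 1ℚ) H≡) W≤H+1) ⟩
      + numerator digits n / 1 ℚ.+ + y / p ≡⟨ cong (ℚ._+ + y / p) (sym H≡) ⟩
      H ℚ.+ + y / p                        ∎

lemma3p6 : (q : ℕ) .{{_ : NonZero q}} → 3 ≤ q →
    (A : Subset q) → 1 < ∣ A ∣ → ∣ A ∣ < q →
    (p : ℕ) .{{_ : NonZero p}} → 2 ≤ p → gcd p q ≡ 1 →
    (x y : ℕ) → InZpStar p x → InZpStar p y → x ∼[ q ] y mod p →
    InK q A ((+ x) / p) ⇔ InK q A ((+ y) / p)
lemma3p6 q _ A _ _ p 2≤p gcd[p,q]≡1 x y x∈ℤₚ* y∈ℤₚ* x∼y = mk⇔
  (∼⇒InK {A} {p} {x} {y} x∼y (proj₁ y∈ℤₚ*) (InZpStar⇒< 2≤p y∈ℤₚ*))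
  (∼⇒InK {A} {p} {y} {x} (∼-sym {p} {q} {x} {y} (gcd≡1⇒coprime gcd[p,q]≡1) x∼y)
    (proj₁ x∈ℤₚ*) (InZpStar⇒< 2≤p x∈ℤₚ*))
  where open Expansion q
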